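{- Let $x, y \in \mathbb{Z}$ and let $p \geq 3$ be a prime such that $x^2 - 2 = y^p$ and $y \neq -1$. Then $v_2(y-1) = 1$, $v_3(y-1) \in \{0, 1\}$, and every prime other than $2$ and $3$ that divides $y-1$ is congruent to $\pm 1 \pmod{12}$.
   Context: $v_\ell(n)$ denotes the $\ell$-adic valuation of $n$. -}

module Defs where

open import Data.Nat using (ℕ; suc; _^_)
open import Data.Integer using (ℤ; +_)
open import Data.Integer.Divisibility using (_∣_)
open import Data.Product using (_×_)
open import Relation.Nullary using (¬_)

-- HasVal ℓ n k  means  v_ℓ(n) = k, i.e. ℓ^k divides n but ℓ^(k+1) does not.
-- (For n = 0 no k satisfies this, matching v_ℓ(0) = ∞.)
HasVal : ℕ → ℤ → ℕ → Set
HasVal ℓ n k = ((+ (ℓ ^ k)) ∣ n) × ¬ ((+ (ℓ ^ suc k)) ∣ n)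

-- Modulo 8 an odd y has y² ≡ 1 and an even y has y³ ≡ 0, so y^p ≡ y³ for every odd p ≥ 3;
-- since x² - 2 is 6, 7 or 2 modulo 8, the equation forces y ≡ 7 (mod 8) and hence v₂(y - 1) = 1.
-- If m divides y - 1 then y^p ≡ 1, that is x² ≡ 3 (mod m). As 3 is not a square modulo 9,
-- v₃(y - 1) ≤ 1. For a prime q ∤ 6 dividing y - 1, Thue's lemma (pigeonhole on u + x v modulo q,
-- 0 ≤ u, v ≤ ⌊√q⌋) yields a ≡ x b (mod q) with 0 < a² + b², a² < q and b² < q. Then
-- 3b² - a² is a multiple of q lying in (-q, 3q), and it is not 0 because √3 is irrational, so
-- a² + j q = 3b² with j ∈ {1, 2}; reducing this modulo 24 gives q ≡ ±1 (mod 12).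

module Submission where

open import Defs
open import Data.Nat as ℕ using (ℕ; zero; suc; NonZero; _≤_; _<_; _≥_; z≤n; s≤s; _%_; _/_)
open import Data.Nat.Primality
  using (Prime; prime?; prime⇒irreducible; prime⇒nonZero; prime⇒nonTrivial; euclidsLemma; ¬prime[1])
open import Data.Nat.Induction using (<-rec)
open import Data.Nat.Tactic.RingSolver renaming (solve-∀ to ℕ-solve-∀) using ()
open import Data.Integer using (ℤ; +_; -[1+_]; _+_; _-_; -_; _*_; _^_; -1ℤ; 0ℤ; 1ℤ; ∣_∣; _%ℕ_; _/ℕ_)
open import Data.Integer.Divisibility using (_∣_)
open import Data.Integer.DivMod using (a≡a%ℕn+[a/ℕn]*n; n%ℕd<d)
open import Data.Integer.Tactic.RingSolver using (solve; solve-∀)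
import Data.Integer.Divisibility.Signed as Signed
import Data.Integer.Properties as ℤ
import Data.Nat.Properties as ℕ
import Data.Nat.Divisibility as ℕ
import Data.Nat.DivMod as ℕ
open import Data.Fin as Fin using (Fin; toℕ; fromℕ<; remQuot; combine)
open import Data.Fin.Properties
  using (toℕ-fromℕ<; toℕ<n; toℕ-injective; all?; pigeonhole; combine-remQuot; <⇒≢)
open import Data.List using (_∷_; [])
open import Data.Product using (∃₂; ∃-syntax; _×_; _,_; proj₁; proj₂; uncurry)
open import Data.Sum as Sum using (_⊎_; inj₁; inj₂; [_,_]′)
open import Function using (_∘_; id)
open import Relation.Nullary using (¬_; Dec; yes; no; contradiction)
open import Relation.Nullary.Decidable using (map′; toWitness; _→-dec_; _⊎-dec_; _×-dec_; ¬?)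
open import Relation.Binary.PropositionalEquality
open import Relation.Binary.Bundles using (Setoid)
open import Level using (0ℓ)
import Relation.Binary.Reasoning.Setoid as ≈-Reasoning

infix 4 _≡_mod_

record _≡_mod_ (a b : ℤ) (m : ℕ) : Set where
  constructor congruent
  field ∣-diff : + m Signed.∣ a - b

open _≡_mod_

_≡?_mod_ : ∀ a b m → Dec (a ≡ b mod m)
a ≡? b mod m = map′ (congruent ∘ Signed.∣ᵤ⇒∣) (Signed.∣⇒∣ᵤ ∘ ∣-diff) (m ℕ.∣? ∣ a - b ∣)

module _ {m : ℕ} where

  mk≡-mod : ∀ {a b c} → + m Signed.∣ c → c ≡ a - b → a ≡ b mod m
  mk≡-mod m∣c refl = congruent m∣c

  ≡⇒≡-mod : ∀ {a b} → a ≡ b → a ≡ b mod m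
  ≡⇒≡-mod {a} refl = congruent (Signed.divides 0ℤ (ℤ.+-inverseʳ a))

  ≡-mod-refl : ∀ {a} → a ≡ a mod m
  ≡-mod-refl = ≡⇒≡-mod refl

  ≡-mod-sym : ∀ {a b} → a ≡ b mod m → b ≡ a mod m
  ≡-mod-sym {a} {b} (congruent m∣a-b) =
    mk≡-mod (Signed.∣m⇒∣-m m∣a-b) (solve (a ∷ b ∷ []))

  ≡-mod-trans : ∀ {a b c} → a ≡ b mod m → b ≡ c mod m → a ≡ c mod m
  ≡-mod-trans {a} {b} {c} (congruent m∣a-b) (congruent m∣b-c) =
    mk≡-mod (Signed.∣m∣n⇒∣m+n m∣a-b m∣b-c) (solve (a ∷ b ∷ c ∷ []))

  +-cong-mod : ∀ {a b c d} → a ≡ b mod m → c ≡ d mod m → a + c ≡ b + d mod m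
  +-cong-mod {a} {b} {c} {d} (congruent m∣a-b) (congruent m∣c-d) =
    mk≡-mod (Signed.∣m∣n⇒∣m+n m∣a-b m∣c-d) (solve (a ∷ b ∷ c ∷ d ∷ []))

  *-cong-mod : ∀ {a b c d} → a ≡ b mod m → c ≡ d mod m → a * c ≡ b * d mod m
  *-cong-mod {a} {b} {c} {d} (congruent m∣a-b) (congruent m∣c-d) =
    mk≡-mod (Signed.∣m∣n⇒∣m+n (Signed.∣m⇒∣m*n c m∣a-b) (Signed.∣n⇒∣m*n b m∣c-d))
      (solve (a ∷ b ∷ c ∷ d ∷ []))

  +-multiple-≡-mod : ∀ a k → a + k * + m ≡ a mod m
  +-multiple-≡-mod a k = mk≡-mod (Signed.divides k refl) (identity a k (+ m))
    where
    identity : ∀ a k m → k * m ≡ a + k * m - a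
    identity = solve-∀

  *-congˡ-mod : ∀ a {b c} → b ≡ c mod m → a * b ≡ a * c mod m
  *-congˡ-mod a = *-cong-mod (≡-mod-refl {a})

  ^-cong-mod : ∀ {a b} n → a ≡ b mod m → a ^ n ≡ b ^ n mod m
  ^-cong-mod zero    a≡b = ≡-mod-refl
  ^-cong-mod (suc n) a≡b = *-cong-mod a≡b (^-cong-mod n a≡b)

≡-mod-setoid : ℕ → Setoid 0ℓ 0ℓ
≡-mod-setoid m = record
  { Carrier       = ℤ
  ; _≈_           = λ a b → a ≡ b mod m
  ; isEquivalence = record { refl = ≡-mod-refl ; sym = ≡-mod-sym ; trans = ≡-mod-trans }
  }

≡-mod-weaken : ∀ {d m a b} → d ℕ.∣ m → a ≡ b mod m → a ≡ b mod d
≡-mod-weaken d∣m (congruent m∣a-b) = congruent (Signed.∣-trans (Signed.∣ᵤ⇒∣ d∣m) m∣a-b)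

∣-diff⇒≡-mod : ∀ {m a b} → + m ∣ a - b → a ≡ b mod m
∣-diff⇒≡-mod = congruent ∘ Signed.∣ᵤ⇒∣

∣⇒≡-mod-0 : ∀ {m a} → + m ∣ a → a ≡ 0ℤ mod m
∣⇒≡-mod-0 {m} {a} m∣a = ∣-diff⇒≡-mod (subst (+ m ∣_) (sym (ℤ.+-identityʳ a)) m∣a)

≡-mod-0⇒∣ : ∀ {m a} → a ≡ 0ℤ mod m → + m ∣ a
≡-mod-0⇒∣ {m} {a} (congruent m∣a-0) = subst (+ m ∣_) (ℤ.+-identityʳ a) (Signed.∣⇒∣ᵤ m∣a-0)

∣-resp-≡-mod : ∀ {d m a b} → d ℕ.∣ m → a ≡ b mod m → + d ∣ a → + d ∣ b
∣-resp-≡-mod d∣m a≡b d∣a =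
  ≡-mod-0⇒∣ (≡-mod-trans (≡-mod-sym (≡-mod-weaken d∣m a≡b)) (∣⇒≡-mod-0 d∣a))

HasVal-resp-≡-mod : ∀ {ℓ k m a b} → ℓ ℕ.^ suc k ℕ.∣ m → a ≡ b mod m → HasVal ℓ a k → HasVal ℓ b k
HasVal-resp-≡-mod {ℓ} ℓᵏ⁺¹∣m a≡b (ℓᵏ∣a , ℓᵏ⁺¹∤a) =
  ∣-resp-≡-mod (ℕ.∣-trans (ℕ.n∣m*n ℓ) ℓᵏ⁺¹∣m) a≡b ℓᵏ∣a ,
  ℓᵏ⁺¹∤a ∘ ∣-resp-≡-mod ℓᵏ⁺¹∣m (≡-mod-sym a≡b)

≡-mod-%ℕ : ∀ m .{{_ : NonZero m}} a → a ≡ + (a %ℕ m) mod m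
≡-mod-%ℕ m a =
  ≡-mod-trans (≡⇒≡-mod (a≡a%ℕn+[a/ℕn]*n a m)) (+-multiple-≡-mod (+ (a %ℕ m)) (a /ℕ m))

residue : ∀ m .{{_ : NonZero m}} → ℤ → Fin m
residue m a = fromℕ< (n%ℕd<d a m)

≡-mod-residue : ∀ m .{{_ : NonZero m}} a → a ≡ + toℕ (residue m a) mod m
≡-mod-residue m a = subst (λ r → a ≡ + r mod m) (sym (toℕ-fromℕ< (n%ℕd<d a m))) (≡-mod-%ℕ m a)

residue-injective : ∀ m .{{_ : NonZero m}} {a b} → residue m a ≡ residue m b → a ≡ b mod m
residue-injective m {a} {b} eq = ≡-mod-trans (≡-mod-residue m a)
  (≡-mod-trans (≡⇒≡-mod (cong (+_ ∘ toℕ) eq)) (≡-mod-sym (≡-mod-residue m b)))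

∣[+m]-[+n]∣≤m⊔n : ∀ m n → ∣ + m - + n ∣ ≤ m ℕ.⊔ n
∣[+m]-[+n]∣≤m⊔n m n = subst (_≤ m ℕ.⊔ n) (cong ∣_∣ (sym (ℤ.[+m]-[+n]≡m⊖n m n))) (ℤ.∣m⊝n∣≤m⊔n m n)

≡-mod-<⇒≡ : ∀ {m r s} → + r ≡ + s mod m → r < m → s < m → r ≡ s
≡-mod-<⇒≡ {m} {r} {s} (congruent m∣r-s) r<m s<m =
  ℤ.+-injective (ℤ.i-j≡0⇒i≡j (+ r) (+ s)
    (ℤ.∣i∣≡0⇒i≡0 (small-multiple (Signed.∣⇒∣ᵤ m∣r-s) ∣r-s∣<m)))
  where
  ∣r-s∣<m : ∣ + r - + s ∣ < m
  ∣r-s∣<m = ℕ.≤-<-trans (∣[+m]-[+n]∣≤m⊔n r s) (ℕ.⊔-pres-<m r<m s<m)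
  small-multiple : ∀ {n} → m ℕ.∣ n → n < m → n ≡ 0
  small-multiple {zero}  _   _   = refl
  small-multiple {suc n} m∣n n<m = contradiction m∣n (ℕ.>⇒∤ n<m)

≡-mod⇒%ℕ≡ : ∀ {m} .{{_ : NonZero m}} {a r} → a ≡ + r mod m → r < m → a %ℕ m ≡ r
≡-mod⇒%ℕ≡ {m} {a = a} a≡r r<m =
  ≡-mod-<⇒≡ (≡-mod-trans (≡-mod-sym (≡-mod-%ℕ m a)) a≡r) (n%ℕd<d a m) r<m

fifth-power-mod-8 : ∀ y → y ^ 5 ≡ y ^ 3 mod 8
fifth-power-mod-8 y = begin
  y ^ 5     ≈⟨ ^-cong-mod 5 y≡r ⟩
  (+ r) ^ 5 ≈⟨ check (residue 8 y) ⟩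
  (+ r) ^ 3 ≈⟨ ^-cong-mod 3 y≡r ⟨
  y ^ 3     ∎
  where
  open ≈-Reasoning (≡-mod-setoid 8)
  r = toℕ (residue 8 y)
  y≡r = ≡-mod-residue 8 y
  check : ∀ (r : Fin 8) → (+ toℕ r) ^ 5 ≡ (+ toℕ r) ^ 3 mod 8
  check = toWitness {a? = all? λ _ → _ ≡? _ mod _} _

odd-power-≡-cube : ∀ {m y} → y ^ 5 ≡ y ^ 3 mod m → ∀ n → 3 ≤ n → ¬ 2 ℕ.∣ n → y ^ n ≡ y ^ 3 mod m
odd-power-≡-cube _ 1 (s≤s ()) _
odd-power-≡-cube _ 2 (s≤s (s≤s ())) _
odd-power-≡-cube _ 3 _ _ = ≡-mod-refl
odd-power-≡-cube _ 4 _ 2∤4 = contradiction (ℕ.divides 2 refl) 2∤4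
odd-power-≡-cube {y = y} y⁵≡y³ (suc (suc (suc (suc (suc n))))) _ 2∤5+n =
  ≡-mod-trans (*-congˡ-mod y (*-congˡ-mod y
    (odd-power-≡-cube {y = y} y⁵≡y³ (suc (suc (suc n))) (s≤s (s≤s (s≤s z≤n)))
      (2∤5+n ∘ ℕ.∣m∣n⇒∣m+n ℕ.∣-refl)))) y⁵≡y³

x²-2≡y³⇒y≡7-mod-8 : ∀ x y → x ^ 2 - + 2 ≡ y ^ 3 mod 8 → y ≡ + 7 mod 8
x²-2≡y³⇒y≡7-mod-8 x y x²-2≡y³ =
  ≡-mod-trans (≡-mod-residue 8 y) (check (residue 8 x) (residue 8 y) (begin
    (+ r) ^ 2 - + 2  ≈⟨ +-cong-mod (^-cong-mod 2 (≡-mod-residue 8 x)) ≡-mod-refl ⟨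
    x ^ 2 - + 2      ≈⟨ x²-2≡y³ ⟩
    y ^ 3            ≈⟨ ^-cong-mod 3 (≡-mod-residue 8 y) ⟩
    (+ s) ^ 3        ∎))
  where
  open ≈-Reasoning (≡-mod-setoid 8)
  r = toℕ (residue 8 x)
  s = toℕ (residue 8 y)
  check : ∀ (r s : Fin 8) → (+ toℕ r) ^ 2 - + 2 ≡ (+ toℕ s) ^ 3 mod 8 → + toℕ s ≡ + 7 mod 8
  check = toWitness {a? = all? λ _ → all? λ _ → _ ≡? _ mod _ →-dec _ ≡? _ mod _} _

x²≢3-mod-9 : ∀ x → ¬ (x ^ 2 ≡ + 3 mod 9)
x²≢3-mod-9 x x²≡3 =
  check (residue 9 x) (≡-mod-trans (^-cong-mod 2 (≡-mod-sym (≡-mod-residue 9 x))) x²≡3)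
  where
  check : ∀ (r : Fin 9) → ¬ ((+ toℕ r) ^ 2 ≡ + 3 mod 9)
  check = toWitness {a? = all? λ _ → ¬? (_ ≡? _ mod _)} _

floor-sqrt : ∀ n → ∃[ s ] s ℕ.* s ≤ n × n < suc s ℕ.* suc s
floor-sqrt zero = 0 , z≤n , s≤s z≤n
floor-sqrt (suc n) with floor-sqrt n
... | s , s²≤n , n<[1+s]² with suc n ℕ.<? suc s ℕ.* suc s
...   | yes 1+n<[1+s]² = s , ℕ.m≤n⇒m≤1+n s²≤n , 1+n<[1+s]²
...   | no  1+n≮[1+s]² = suc s , ℕ.≤-reflexive [1+s]²≡1+n ,
                         subst (_< suc (suc s) ℕ.* suc (suc s)) [1+s]²≡1+n
                           (ℕ.*-mono-< (ℕ.n<1+n (suc s)) (ℕ.n<1+n (suc s)))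
  where
  [1+s]²≡1+n : suc s ℕ.* suc s ≡ suc n
  [1+s]²≡1+n = ℕ.≤-antisym (ℕ.≮⇒≥ 1+n≮[1+s]²) n<[1+s]²

prime-∤ : ∀ {d q} → Prime q → d ≢ 1 → d ≢ q → ¬ d ℕ.∣ q
prime-∤ q-prime d≢1 d≢q d∣q = [ d≢1 , d≢q ]′ (prime⇒irreducible q-prime d∣q)

prime⇒¬square : ∀ {q} s → Prime q → s ℕ.* s ≢ q
prime⇒¬square {q} s q-prime s²≡q with prime⇒irreducible q-prime (ℕ.divides s (sym s²≡q))
... | inj₁ refl = ¬prime[1] (subst Prime (sym s²≡q) q-prime)
... | inj₂ refl = ¬prime[1] (subst Prime q≡1 q-prime)
  where
  instance _ = prime⇒nonZero q-prime
  q≡1 : q ≡ 1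
  q≡1 = ℕ.*-cancelʳ-≡ q 1 q (trans s²≡q (sym (ℕ.*-identityˡ q)))

prime[3] : Prime 3
prime[3] = toWitness {a? = prime? 3} _

m*m≡p*[n*n]⇒m≡0 : ∀ {p} → Prime p → ∀ m n → m ℕ.* m ≡ p ℕ.* (n ℕ.* n) → m ≡ 0
m*m≡p*[n*n]⇒m≡0 {p} p-prime = <-rec _ descent
  where
  instance
    _ = prime⇒nonZero p-prime
    _ = prime⇒nonTrivial p-prime

  p∣square : ∀ a b → a ℕ.* a ≡ p ℕ.* (b ℕ.* b) → ∃[ c ] a ≡ c ℕ.* p × b ℕ.* b ≡ p ℕ.* (c ℕ.* c)
  p∣square a b a²≡pb² = c , a≡cp , ℕ.*-cancelˡ-≡ _ _ p (begin
    p ℕ.* (b ℕ.* b)           ≡⟨ a²≡pb² ⟨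
    a ℕ.* a                   ≡⟨ cong (λ x → x ℕ.* x) a≡cp ⟩
    c ℕ.* p ℕ.* (c ℕ.* p)     ≡⟨ [cp]²≡p[pc²] c p ⟩
    p ℕ.* (p ℕ.* (c ℕ.* c))   ∎)
    where
    open ≡-Reasoning
    p∣a : p ℕ.∣ a
    p∣a = [ id , id ]′ (euclidsLemma a a p-prime
            (ℕ.divides (b ℕ.* b) (trans a²≡pb² (ℕ.*-comm p _))))
    c = ℕ.quotient p∣a
    a≡cp = ℕ.m∣n⇒n≡quotient*m p∣a
    [cp]²≡p[pc²] : ∀ c p → c ℕ.* p ℕ.* (c ℕ.* p) ≡ p ℕ.* (p ℕ.* (c ℕ.* c))
    [cp]²≡p[pc²] = ℕ-solve-∀

  descent : ∀ m → (∀ {k} → k < m → ∀ n → k ℕ.* k ≡ p ℕ.* (n ℕ.* n) → k ≡ 0) →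
            ∀ n → m ℕ.* m ≡ p ℕ.* (n ℕ.* n) → m ≡ 0
  descent m rec n m²≡pn² = from-quotient (p∣square m n m²≡pn²)
    where
    from-quotient : ∃[ k ] m ≡ k ℕ.* p × n ℕ.* n ≡ p ℕ.* (k ℕ.* k) → m ≡ 0
    from-quotient (zero  , m≡0  , _)      = m≡0
    from-quotient (suc k , m≡kp , n²≡pk²) =
      let l , _ , k²≡pl² = p∣square n (suc k) n²≡pk²
          k<m = subst (suc k <_) (sym m≡kp) (ℕ.m<m*n (suc k) p (ℕ.nonTrivial⇒n>1 p))
      in  trans m≡kp (cong (ℕ._* p) (rec k<m l k²≡pl²))

thue : ∀ q .{{_ : NonZero q}} c s → q < suc s ℕ.* suc s →
       ∃[ a ] ∃[ b ] ∣ a ∣ ≤ s × ∣ b ∣ ≤ s × ¬ (a ≡ 0ℤ × b ≡ 0ℤ) × a ≡ c * b mod q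
thue q c s q<[1+s]² = from-collision (pigeonhole q<[1+s]² f)
  where
  u v : Fin (suc s ℕ.* suc s) → ℕ
  u i = toℕ (proj₁ (remQuot {suc s} (suc s) i))
  v i = toℕ (proj₂ (remQuot {suc s} (suc s) i))

  point : Fin (suc s ℕ.* suc s) → ℤ
  point i = + u i + c * + v i

  f : Fin (suc s ℕ.* suc s) → Fin q
  f i = residue q (point i)

  u≤s : ∀ i → u i ≤ s
  u≤s i = ℕ.s≤s⁻¹ (toℕ<n (proj₁ (remQuot {suc s} (suc s) i)))
  v≤s : ∀ i → v i ≤ s
  v≤s i = ℕ.s≤s⁻¹ (toℕ<n (proj₂ (remQuot {suc s} (suc s) i)))

  distance≤s : ∀ {m n} → m ≤ s → n ≤ s → ∣ + m - + n ∣ ≤ s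
  distance≤s {m} {n} m≤s n≤s = ℕ.≤-trans (∣[+m]-[+n]∣≤m⊔n m n) (ℕ.⊔-lub m≤s n≤s)

  difference≡0 : ∀ {m n} → + m - + n ≡ 0ℤ → m ≡ n
  difference≡0 {m} {n} = ℤ.+-injective ∘ ℤ.i-j≡0⇒i≡j (+ m) (+ n)

  coords-injective : ∀ {i j} → u i ≡ u j → v i ≡ v j → i ≡ j
  coords-injective {i} {j} uᵢ≡uⱼ vᵢ≡vⱼ = begin
    i                                           ≡⟨ combine-remQuot {suc s} (suc s) i ⟨
    uncurry combine (remQuot {suc s} (suc s) i) ≡⟨ cong (uncurry combine) remQuotᵢ≡remQuotⱼ ⟩
    uncurry combine (remQuot {suc s} (suc s) j) ≡⟨ combine-remQuot {suc s} (suc s) j ⟩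
    j                                           ∎
    where
    open ≡-Reasoning
    remQuotᵢ≡remQuotⱼ = cong₂ _,_ (toℕ-injective uᵢ≡uⱼ) (toℕ-injective vᵢ≡vⱼ)

  rearrange : ∀ uᵢ vᵢ uⱼ vⱼ c → (uᵢ + c * vᵢ) - (uⱼ + c * vⱼ) ≡ (uᵢ - uⱼ) - c * (vⱼ - vᵢ)
  rearrange = solve-∀

  from-collision : (∃₂ λ i j → i Fin.< j × f i ≡ f j) →
                   ∃[ a ] ∃[ b ] ∣ a ∣ ≤ s × ∣ b ∣ ≤ s × ¬ (a ≡ 0ℤ × b ≡ 0ℤ) × a ≡ c * b mod q
  from-collision (i , j , i<j , fᵢ≡fⱼ) =
    + u i - + u j , + v j - + v i ,
    distance≤s (u≤s i) (u≤s j) , distance≤s (v≤s j) (v≤s i) ,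
    (λ (a≡0 , b≡0) → <⇒≢ i<j (coords-injective (difference≡0 a≡0) (sym (difference≡0 b≡0)))) ,
    mk≡-mod (∣-diff (residue-injective q {point i} {point j} fᵢ≡fⱼ))
            (rearrange (+ u i) (+ v i) (+ u j) (+ v j) c)

≡-mod⇒≡+small-multiple : ∀ {q X Y k} .{{_ : NonZero q}} → X < q → Y < k ℕ.* q → + Y ≡ + X mod q →
                         ∃[ j ] j < k × Y ≡ X ℕ.+ j ℕ.* q
≡-mod⇒≡+small-multiple {q} {X} {Y} X<q Y<kq Y≡X = Y / q , ℕ.m<n*o⇒m/o<n Y<kq , (begin
  Y                     ≡⟨ ℕ.m≡m%n+[m/n]*n Y q ⟩
  Y % q ℕ.+ Y / q ℕ.* q ≡⟨ cong (ℕ._+ Y / q ℕ.* q) (≡-mod⇒%ℕ≡ Y≡X X<q) ⟩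
  X ℕ.+ Y / q ℕ.* q     ∎)
  where open ≡-Reasoning

small-solution⇒A²+jq≡3B² : ∀ {q A B} .{{_ : NonZero q}} →
  A ℕ.* A < q → B ℕ.* B < q → ¬ (A ≡ 0 × B ≡ 0) → + (A ℕ.* A) ≡ + (3 ℕ.* (B ℕ.* B)) mod q →
  ∃[ j ] (j ≡ 1 ⊎ j ≡ 2) × A ℕ.* A ℕ.+ j ℕ.* q ≡ 3 ℕ.* (B ℕ.* B)
small-solution⇒A²+jq≡3B² {q} {A} {B} A²<q B²<q A,B≢0 A²≡3B² =
  from-quotient (≡-mod⇒≡+small-multiple A²<q (ℕ.*-monoʳ-< 3 B²<q) (≡-mod-sym A²≡3B²))
  where
  from-quotient : ∃[ j ] j < 3 × 3 ℕ.* (B ℕ.* B) ≡ A ℕ.* A ℕ.+ j ℕ.* q →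
                  ∃[ j ] (j ≡ 1 ⊎ j ≡ 2) × A ℕ.* A ℕ.+ j ℕ.* q ≡ 3 ℕ.* (B ℕ.* B)
  from-quotient (0 , _ , 3B²≡A²+0) = contradiction (A≡0 , B≡0) A,B≢0
    where
    A≡0 : A ≡ 0
    A≡0 = m*m≡p*[n*n]⇒m≡0 prime[3] A B (sym (trans 3B²≡A²+0 (ℕ.+-identityʳ (A ℕ.* A))))
    B*B≡0 : B ℕ.* B ≡ 0
    B*B≡0 = ℕ.*-cancelˡ-≡ (B ℕ.* B) 0 3 (trans 3B²≡A²+0 (cong (λ a → a ℕ.* a ℕ.+ 0) A≡0))
    B≡0 : B ≡ 0
    B≡0 = [ id , id ]′ (ℕ.m*n≡0⇒m≡0∨n≡0 B B*B≡0)
  from-quotient (1 , _ , 3B²≡A²+q)  = 1 , inj₁ refl , sym 3B²≡A²+q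
  from-quotient (2 , _ , 3B²≡A²+2q) = 2 , inj₂ refl , sym 3B²≡A²+2q
  from-quotient (suc (suc (suc _)) , s≤s (s≤s (s≤s ())) , _)

i*i≡∣i∣*∣i∣ : ∀ i → i * i ≡ + (∣ i ∣ ℕ.* ∣ i ∣)
i*i≡∣i∣*∣i∣ (+ n)    = sym (ℤ.pos-* n n)
i*i≡∣i∣*∣i∣ -[1+ n ] = refl

x²≡3⇒∣a∣²≡3∣b∣² : ∀ {q x a b} → x ^ 2 ≡ + 3 mod q → a ≡ x * b mod q →
                   + (∣ a ∣ ℕ.* ∣ a ∣) ≡ + (3 ℕ.* (∣ b ∣ ℕ.* ∣ b ∣)) mod q
x²≡3⇒∣a∣²≡3∣b∣² {q} {x} {a} {b} x²≡3 a≡xb = begin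
  + (∣ a ∣ ℕ.* ∣ a ∣)         ≡⟨ i*i≡∣i∣*∣i∣ a ⟨
  a * a                        ≈⟨ *-cong-mod a≡xb a≡xb ⟩
  x * b * (x * b)              ≡⟨ solve (x ∷ b ∷ []) ⟩
  x * x * (b * b)              ≡⟨ cong (λ y → x * y * (b * b)) (ℤ.*-identityʳ x) ⟨
  x ^ 2 * (b * b)              ≈⟨ *-cong-mod x²≡3 ≡-mod-refl ⟩
  + 3 * (b * b)                ≡⟨ cong (+ 3 *_) (i*i≡∣i∣*∣i∣ b) ⟩
  + 3 * + (∣ b ∣ ℕ.* ∣ b ∣)   ≡⟨ ℤ.pos-* 3 (∣ b ∣ ℕ.* ∣ b ∣) ⟨
  + (3 ℕ.* (∣ b ∣ ℕ.* ∣ b ∣)) ∎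
  where open ≈-Reasoning (≡-mod-setoid q)

x²≡3⇒A²+jq≡3B² : ∀ {q} → Prime q → ∀ x → x ^ 2 ≡ + 3 mod q →
                 ∃[ A ] ∃[ B ] ∃[ j ] (j ≡ 1 ⊎ j ≡ 2) × A ℕ.* A ℕ.+ j ℕ.* q ≡ 3 ℕ.* (B ℕ.* B)
x²≡3⇒A²+jq≡3B² {q} q-prime x x²≡3 =
  let s , s²≤q , q<[1+s]² = floor-sqrt q
  in  from-thue s (ℕ.≤∧≢⇒< s²≤q (prime⇒¬square s q-prime)) (thue q x s q<[1+s]²)
  where
  instance _ = prime⇒nonZero q-prime

  from-thue : ∀ s → s ℕ.* s < q →
              (∃[ a ] ∃[ b ] ∣ a ∣ ≤ s × ∣ b ∣ ≤ s × ¬ (a ≡ 0ℤ × b ≡ 0ℤ) × a ≡ x * b mod q) →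
              ∃[ A ] ∃[ B ] ∃[ j ] (j ≡ 1 ⊎ j ≡ 2) × A ℕ.* A ℕ.+ j ℕ.* q ≡ 3 ℕ.* (B ℕ.* B)
  from-thue s s²<q (a , b , ∣a∣≤s , ∣b∣≤s , a,b≢0 , a≡xb) =
    ∣ a ∣ , ∣ b ∣ , small-solution⇒A²+jq≡3B² (square<q ∣a∣≤s) (square<q ∣b∣≤s) A,B≢0
                      (x²≡3⇒∣a∣²≡3∣b∣² {x = x} {b = b} x²≡3 a≡xb)
    where
    square<q : ∀ {n} → n ≤ s → n ℕ.* n < q
    square<q n≤s = ℕ.≤-<-trans (ℕ.*-mono-≤ n≤s n≤s) s²<q

    A,B≢0 : ¬ (∣ a ∣ ≡ 0 × ∣ b ∣ ≡ 0)
    A,B≢0 (∣a∣≡0 , ∣b∣≡0) = a,b≢0 (ℤ.∣i∣≡0⇒i≡0 ∣a∣≡0 , ℤ.∣i∣≡0⇒i≡0 ∣b∣≡0)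

A²+jq≡3B²⇒q≡±1-mod-12 : ∀ {j A B q} → j ≡ 1 ⊎ j ≡ 2 → ¬ 2 ℕ.∣ q → ¬ 3 ℕ.∣ q →
                        A ℕ.* A ℕ.+ j ℕ.* q ≡ 3 ℕ.* (B ℕ.* B) → q % 12 ≡ 1 ⊎ q % 12 ≡ 11
A²+jq≡3B²⇒q≡±1-mod-12 {j} {A} {B} {q} j≡1∨2 2∤q 3∤q A²+jq≡3B² =
  Sum.map (residue⇒%12 (s≤s (s≤s z≤n))) (residue⇒%12 ℕ.≤-refl)
    (check j≡1∨2 (residue 24 (+ A)) (residue 24 (+ B)) (residue 24 (+ q)) reduced
      (2∤q ∘ ∣-resp-≡-mod (ℕ.divides 12 refl) (≡-mod-sym q≡r))
      (3∤q ∘ ∣-resp-≡-mod (ℕ.divides 8 refl) (≡-mod-sym q≡r)))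
  where
  check : ∀ {j} → j ≡ 1 ⊎ j ≡ 2 → ∀ (a b r : Fin 24) →
          + toℕ a * + toℕ a + + j * + toℕ r ≡ + 3 * (+ toℕ b * + toℕ b) mod 24 →
          ¬ 2 ℕ.∣ toℕ r → ¬ 3 ℕ.∣ toℕ r → + toℕ r ≡ 1ℤ mod 12 ⊎ + toℕ r ≡ + 11 mod 12
  check (inj₁ refl) = toWitness {a? = all? λ _ → all? λ _ → all? λ _ →
    _ ≡? _ mod _ →-dec ¬? (_ ℕ.∣? _) →-dec ¬? (_ ℕ.∣? _) →-dec (_ ≡? _ mod _ ⊎-dec _ ≡? _ mod _)} _
  check (inj₂ refl) = toWitness {a? = all? λ _ → all? λ _ → all? λ _ →
    _ ≡? _ mod _ →-dec ¬? (_ ℕ.∣? _) →-dec ¬? (_ ℕ.∣? _) →-dec (_ ≡? _ mod _ ⊎-dec _ ≡? _ mod _)} _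

  a = + toℕ (residue 24 (+ A))
  b = + toℕ (residue 24 (+ B))
  r = + toℕ (residue 24 (+ q))
  A≡a = ≡-mod-residue 24 (+ A)
  B≡b = ≡-mod-residue 24 (+ B)
  q≡r = ≡-mod-residue 24 (+ q)

  reduced : a * a + + j * r ≡ + 3 * (b * b) mod 24
  reduced = begin
    a * a + + j * r              ≈⟨ +-cong-mod (*-cong-mod A≡a A≡a) (*-congˡ-mod (+ j) q≡r) ⟨
    + A * + A + + j * + q        ≡⟨ cong₂ _+_ (ℤ.pos-* A A) (ℤ.pos-* j q) ⟨
    + (A ℕ.* A) + + (j ℕ.* q)    ≡⟨ ℤ.pos-+ (A ℕ.* A) (j ℕ.* q) ⟨
    + (A ℕ.* A ℕ.+ j ℕ.* q)      ≡⟨ cong +_ A²+jq≡3B² ⟩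
    + (3 ℕ.* (B ℕ.* B))          ≡⟨ ℤ.pos-* 3 (B ℕ.* B) ⟩
    + 3 * + (B ℕ.* B)            ≡⟨ cong (+ 3 *_) (ℤ.pos-* B B) ⟩
    + 3 * (+ B * + B)            ≈⟨ *-congˡ-mod (+ 3) (*-cong-mod B≡b B≡b) ⟩
    + 3 * (b * b)                ∎
    where open ≈-Reasoning (≡-mod-setoid 24)

  residue⇒%12 : ∀ {k} → k < 12 → r ≡ + k mod 12 → q % 12 ≡ k
  residue⇒%12 k<12 r≡k = ≡-mod⇒%ℕ≡ (≡-mod-trans (≡-mod-weaken (ℕ.divides 2 refl) q≡r) r≡k) k<12

x²-2≡yᵖ⇒x²≡3 : ∀ {m} x y p → x ^ 2 - + 2 ≡ y ^ p → y ≡ 1ℤ mod m → x ^ 2 ≡ + 3 mod m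
x²-2≡yᵖ⇒x²≡3 {m} x y p x²-2≡yᵖ y≡1 = begin
  x ^ 2               ≡⟨ trans (ℤ.+-assoc (x ^ 2) (- + 2) (+ 2)) (ℤ.+-identityʳ (x ^ 2)) ⟨
  x ^ 2 - + 2 + + 2   ≡⟨ cong (_+ + 2) x²-2≡yᵖ ⟩
  y ^ p + + 2         ≈⟨ +-cong-mod (^-cong-mod p y≡1) ≡-mod-refl ⟩
  1ℤ ^ p + + 2        ≡⟨ cong (_+ + 2) (ℤ.^-zeroˡ p) ⟩
  + 3                 ∎
  where open ≈-Reasoning (≡-mod-setoid m)

x²-2≡yᵖ⇒y≡7-mod-8 : ∀ x y {p} → 3 ≤ p → ¬ 2 ℕ.∣ p → x ^ 2 - + 2 ≡ y ^ p → y ≡ + 7 mod 8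
x²-2≡yᵖ⇒y≡7-mod-8 x y {p} 3≤p 2∤p x²-2≡yᵖ = x²-2≡y³⇒y≡7-mod-8 x y
  (≡-mod-trans (≡⇒≡-mod x²-2≡yᵖ) (odd-power-≡-cube (fifth-power-mod-8 y) p 3≤p 2∤p))

x²≡3⇒q≡±1-mod-12 : ∀ {q} → Prime q → q ≢ 2 → q ≢ 3 → ∀ x → x ^ 2 ≡ + 3 mod q →
                   q % 12 ≡ 1 ⊎ q % 12 ≡ 11
x²≡3⇒q≡±1-mod-12 q-prime q≢2 q≢3 x x²≡3 =
  let A , B , j , j≡1∨2 , A²+jq≡3B² = x²≡3⇒A²+jq≡3B² q-prime x x²≡3
  in  A²+jq≡3B²⇒q≡±1-mod-12 {A = A} {B} j≡1∨2
        (prime-∤ q-prime (λ ()) (q≢2 ∘ sym)) (prime-∤ q-prime (λ ()) (q≢3 ∘ sym)) A²+jq≡3B²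

theorem2p7 : (x y : ℤ) (p : ℕ) → Prime p → p ≥ 3 →
    x ^ 2 - + 2 ≡ y ^ p → y ≢ -1ℤ →
    HasVal 2 (y - 1ℤ) 1
    × (HasVal 3 (y - 1ℤ) 0 ⊎ HasVal 3 (y - 1ℤ) 1)
    × ((q : ℕ) → Prime q → q ≢ 2 → q ≢ 3 → (+ q) ∣ (y - 1ℤ) →
        (q % 12 ≡ 1) ⊎ (q % 12 ≡ 11))
theorem2p7 x y p p-prime p≥3 x²-2≡yᵖ _ = v₂ , v₃ , prime-divisors
  where
  x²≡3 : ∀ {m} → y ≡ 1ℤ mod m → x ^ 2 ≡ + 3 mod m
  x²≡3 = x²-2≡yᵖ⇒x²≡3 x y p x²-2≡yᵖ

  y-1≡6 : y - 1ℤ ≡ + 6 mod 8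
  y-1≡6 = +-cong-mod (x²-2≡yᵖ⇒y≡7-mod-8 x y p≥3 2∤p x²-2≡yᵖ) ≡-mod-refl
    where 2∤p = prime-∤ p-prime (λ ()) (ℕ.<⇒≢ p≥3)

  v₂ : HasVal 2 (y - 1ℤ) 1
  v₂ = HasVal-resp-≡-mod {2} {1} (ℕ.divides 2 refl) (≡-mod-sym y-1≡6)
         (toWitness {a? = (_ ℕ.∣? _) ×-dec ¬? (_ ℕ.∣? _)} _)

  v₃ : HasVal 3 (y - 1ℤ) 0 ⊎ HasVal 3 (y - 1ℤ) 1
  v₃ with 3 ℕ.∣? ∣ y - 1ℤ ∣
  ... | no  3∤y-1 = inj₁ (ℕ.1∣ _ , 3∤y-1)
  ... | yes 3∣y-1 = inj₂ (3∣y-1 , x²≢3-mod-9 x ∘ x²≡3 ∘ ∣-diff⇒≡-mod)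

  prime-divisors : (q : ℕ) → Prime q → q ≢ 2 → q ≢ 3 → (+ q) ∣ (y - 1ℤ) →
                   (q % 12 ≡ 1) ⊎ (q % 12 ≡ 11)
  prime-divisors q q-prime q≢2 q≢3 = x²≡3⇒q≡±1-mod-12 q-prime q≢2 q≢3 x ∘ x²≡3 ∘ ∣-diff⇒≡-mod
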